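{- Let $\mathcal{T}$ be a single-elimination tournament with at least two players, let $R$ be a uniformly random bracket of $\mathcal{T}$, and define \[q_{\mathrm{pair}}=\min_{a,b\in P(\mathcal{T}),\,a\ne b}\Pr[R(x_{a,b})\in\{a,b\}].\] If $\mathcal{T}$ has $N$ brackets in total, then for every scoring system $\sigma$, $\mathrm{res}(\mathcal{T},\sigma)>(1-q_{\mathrm{pair}})N$.
   Context: For a digraph, $N^+(v)$ is the set of out-neighbours of $v$ and $N^-(v)$ the set of in-neighbours; a sink has $N^+(v)=\emptyset$, a source has $N^-(v)=\emptyset$. A single-elimination tournament $\mathcal{T}$ is a finite digraph with: exactly one sink; $|N^+(v)|=1$ for every non-sink $v$; no directed cycles; and $|N^-(v)|\ne 1$ for every vertex $v$. Players $P(\mathcal{T})$ are the sources; matches $M(\mathcal{T})$ are the non-sources. A directed walk from $u_1$ to $u_t$ is a sequence $(u_1,\dots,u_t)$, $t\ge1$, with $u_{i+1}\in N^+(u_i)$; the player set $P(u)$ of a vertex $u$ is the set of players $a$ with a directed walk from $a$ to $u$. For distinct players $a,b$, $x_{a,b}$ denotes the unique match $x$ having in-neighbours $u_a,u_b\in N^-(x)$ with $P(u_a)\cap\{a,b\}=\{a\}$ and $P(u_b)\cap\{a,b\}=\{b\}$ (such a match exists and is unique). A bracket is a function $B:V(\mathcal{T})\to P(\mathcal{T})$ with $B(a)=a$ for every player $a$ and $B(x)\in\{B(u):u\in N^-(x)\}$ for every match $x$. A scoring system is a function $\sigma:M(\mathcal{T})\to\mathbb{R}_{>0}$; $\mathrm{score}_\sigma(B,B')=\sum_{x\in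 M(\mathcal{T}):B(x)=B'(x)}\sigma(x)$. A set of brackets $\mathcal{B}$ is $\sigma$-resolving if for all pairs of distinct brackets $B,B'$ there is $B_i\in\mathcal{B}$ with $\mathrm{score}_\sigma(B_i,B)\ne\mathrm{score}_\sigma(B_i,B')$. $\mathrm{res}(\mathcal{T},\sigma)$ is the minimum $r$ such that every set of $r$ brackets of $\mathcal{T}$ is $\sigma$-resolving. -}

module Defs where

open import Level using (Level)
open import Data.Nat using (ℕ; zero; suc; _≟_; _≤_)
open import Data.Fin using (Fin)
import Data.Fin.Properties as FinP
open import Data.Fin.Subset using (Subset; _∈_; _∉_; ∣_∣)
open import Data.Vec using (Vec; lookup; tabulate)
open import Data.List using (List; []; _∷_; length; filter; foldr)
open import Data.List.Membership.Propositional using () renaming (_∈_ to _∈ₗ_)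
open import Data.List.Relation.Unary.Unique.Propositional using (Unique)
open import Data.Product using (Σ; ∃; ∃-syntax; _×_; _,_)
open import Data.Sum using (_⊎_)
open import Data.List using (allFin)
open import Relation.Nullary using (¬_; Dec; yes; no)
open import Relation.Nullary.Decidable using (¬?)
open import Relation.Binary.PropositionalEquality using (_≡_; _≢_)
open import Algebra.Bundles using (CommutativeMonoid)
open import Function.Bundles using (_⇔_)

Digraph : ℕ → Set
Digraph n = Fin n → Subset n

module _ {n : ℕ} (G : Digraph n) where

  outNbrs : Fin n → Subset n
  outNbrs v = G v

  inNbrs : Fin n → Subset n
  inNbrs v = tabulate (λ u → lookup (G u) v)

  Edge : Fin n → Fin n → Set
  Edge u v = v ∈ G u

  IsSink : Fin n → Set
  IsSink v = ∣ outNbrs v ∣ ≡ 0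

  IsSource : Fin n → Set
  IsSource v = ∣ inNbrs v ∣ ≡ 0

  data Walk : Fin n → Fin n → Set where
    here : ∀ {u} → Walk u u
    step : ∀ {u w v} → Edge u w → Walk w v → Walk u v

  record IsSingleElimination : Set where
    field
      uniqueSink  : Σ (Fin n) λ s → IsSink s × (∀ v → IsSink v → v ≡ s)
      outDegOne   : ∀ v → ¬ IsSink v → ∣ outNbrs v ∣ ≡ 1
      acyclic     : ∀ u w → Edge u w → ¬ Walk w u
      inDegNotOne : ∀ v → ∣ inNbrs v ∣ ≢ 1

  IsPlayer : Fin n → Set
  IsPlayer = IsSource

  IsMatch : Fin n → Set
  IsMatch v = ¬ IsSource v

  isMatch? : (v : Fin n) → Dec (IsMatch v)
  isMatch? v = ¬? (∣ inNbrs v ∣ ≟ 0)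

  InPlayerSet : Fin n → Fin n → Set
  InPlayerSet a u = IsPlayer a × Walk a u

  IsXab : Fin n → Fin n → Fin n → Set
  IsXab a b x =
    IsMatch x ×
    Σ (Fin n) λ ua → Σ (Fin n) λ ub →
      ua ∈ inNbrs x × ub ∈ inNbrs x ×
      (InPlayerSet a ua × ¬ InPlayerSet b ua) ×
      (InPlayerSet b ub × ¬ InPlayerSet a ub)

  Bracket : Set
  Bracket = Vec (Fin n) n

  record IsBracket (B : Bracket) : Set where
    field
      intoPlayers : ∀ v → IsPlayer (lookup B v)
      onPlayers   : ∀ a → IsPlayer a → lookup B a ≡ a
      onMatches   : ∀ x → IsMatch x →
                    Σ (Fin n) λ u → u ∈ inNbrs x × lookup B x ≡ lookup B u

  PairEvent : Fin n → Fin n → Bracket → Set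
  PairEvent a b B = Σ (Fin n) λ x → IsXab a b x × (lookup B x ≡ a ⊎ lookup B x ≡ b)

-- Cardinality of a set of elements of a type A (with ≡ as equality):
-- Card P k  means  |{ a | P a }| = k.

Card : ∀ {a p} {A : Set a} → (A → Set p) → ℕ → Set _
Card {A = A} P k =
  Σ (List A) λ L → Unique L × (∀ x → (x ∈ₗ L) ⇔ P x) × length L ≡ k

-- Scoring, with values in an arbitrary commutative monoid (ℝ,+,0) is
-- the case of the paper.

module Scoring {c ℓ : Level} (R : CommutativeMonoid c ℓ) {n : ℕ} (G : Digraph n) where
  open CommutativeMonoid R renaming (Carrier to V)

  score : (Fin n → V) → Bracket G → Bracket G → V
  score σ B B' =
    foldr (λ x acc → σ x ∙ acc) ε
      (filter (λ x → FinP._≟_ (lookup B x) (lookup B' x))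
        (filter (isMatch? G) (allFin n)))

  IsResolving : (Fin n → V) → List (Bracket G) → Set _
  IsResolving σ L =
    ∀ B B' → IsBracket G B → IsBracket G B' → B ≢ B' →
      Σ (Bracket G) λ Bi → Bi ∈ₗ L × ¬ (score σ Bi B ≈ score σ Bi B')

  AllResolving : (Fin n → V) → ℕ → Set _
  AllResolving σ r =
    ∀ (L : List (Bracket G)) → Unique L → (∀ B → B ∈ₗ L → IsBracket G B) →
      length L ≡ r → IsResolving σ L

  IsRes : (Fin n → V) → ℕ → Set _
  IsRes σ r = AllResolving σ r × (∀ r′ → AllResolving σ r′ → r ≤ r′)

-- c is the minimum over distinct players a ≠ b of
--   #{ brackets B | B(x_{a,b}) ∈ {a,b} }   ( = N · q_pair )

IsMinPairCount : ∀ {n} (G : Digraph n) → ℕ → Set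
IsMinPairCount {n} G c =
  (Σ (Fin n) λ a → Σ (Fin n) λ b →
     IsPlayer G a × IsPlayer G b × a ≢ b ×
     Card (λ B → IsBracket G B × PairEvent G a b B) c)
  × (∀ a b → IsPlayer G a → IsPlayer G b → a ≢ b → ∀ k →
       Card (λ B → IsBracket G B × PairEvent G a b B) k → c ≤ k)

{-# OPTIONS --safe #-}

-- Fix players a ≠ b attaining q_pair and let x = x_{a,b}.  A priority list of players defines a
-- bracket: every vertex goes to the first listed player of its player set.  Listing first some
-- players that reach every match after x but not x itself, and then a, b in either order, gives two
-- brackets that differ only at x, one picking a there and the other b.  A bracket R with
-- R(x) ∉ {a, b} scores both identically, so no set of such brackets is resolving; and at least
-- N − N·q_pair brackets avoid {a, b} at x.

module Submission where

open import Defs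
open import Level using (Level)
import Data.Nat as ℕ
open import Data.Nat using (ℕ; zero; suc; _<_; _∸_; _≤_; _+_; z≤n; s≤s)
open import Data.Nat.Properties
  using (module ≤-Reasoning; ≤-antisym; ≤-trans; <-irrefl; ≤⇒≯; ≰⇒>; ∸-monoʳ-≤; m+n∸m≡n; m≤n⇒m⊓n≡m; +-suc)
open import Data.Fin using (Fin; _≟_)
open import Data.Fin.Properties using (any?)
open import Data.Fin.Subset using (Subset; ⁅_⁆; ∣_∣; _⊆_; _⊂_; Nonempty) renaming (_∈_ to _∈ˢ_; _∉_ to _∉ˢ_)
open import Data.Fin.Subset.Properties
  using (x∈⁅x⁆; x∈⁅y⁆⇒x≡y; x≢y⇒x∉⁅y⁆; ∣⁅x⁆∣≡1; p⊆q⇒∣p∣≤∣q∣; p⊂q⇒∣p∣<∣q∣; nonempty?; Empty-unique; ∣⊥∣≡0)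
  renaming (_∈?_ to _∈ˢ?_)
open import Data.Vec using (lookup; tabulate)
open import Data.Vec.Properties using ([]=⇒lookup; lookup⇒[]=; lookup∘tabulate)
open import Data.List using (List; []; _∷_; _++_; length; filter; take; find; allFin; foldr)
open import Data.List.Properties using (filter-≐; length-take; length-removeAt′; length-tabulate)
open import Data.List.Membership.Propositional.Properties using (∈-filter⁻; ∈-allFin; ∈-++⁺ʳ)
import Data.List.Membership.DecPropositional as DecMembership
open import Data.List.Membership.Propositional using (_∈_; _─_; lose)
open import Data.List.Relation.Binary.Subset.Propositional using () renaming (_⊆_ to _⊆ˡ_)
open import Data.List.Relation.Unary.Any using (Any; here; there; index)
open import Data.List.Relation.Unary.Any.Properties using (¬Any[])
open import Data.List.Relation.Unary.All as All using (All; []; _∷_)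
import Data.List.Relation.Unary.All.Properties as Allₚ
open import Data.List.Relation.Unary.AllPairs using ([]; _∷_)
open import Data.List.Relation.Unary.Unique.Propositional using (Unique)
import Data.List.Relation.Unary.Unique.Propositional.Properties as Unique
open import Data.Maybe using (just; fromMaybe)
open import Data.Product using (Σ; ∃; _×_; _,_; proj₁; proj₂)
open import Data.Sum as Sum using (_⊎_; inj₁; inj₂)
open import Data.Empty using (⊥)
open import Algebra.Bundles using (CommutativeMonoid)
open import Function using (_∘_; id)
open import Function.Bundles using (Equivalence)
open import Relation.Nullary using (¬_; Dec; yes; no; contradiction; ¬?; _×-dec_; _⊎-dec_)
open import Relation.Nullary.Decidable as Dec using (decidable-stable)
open import Relation.Unary using (Pred; Decidable)
open import Relation.Binary.PropositionalEquality
  using (_≡_; _≢_; refl; sym; trans; cong; subst)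

module _ {n : ℕ} {p : Subset n} where

  x∈p⇒⁅x⁆⊆p : ∀ {x} → x ∈ˢ p → ⁅ x ⁆ ⊆ p
  x∈p⇒⁅x⁆⊆p {x} x∈p y∈⁅x⁆ = subst (_∈ˢ p) (sym (x∈⁅y⁆⇒x≡y x y∈⁅x⁆)) x∈p

  x∈p⇒∣p∣>0 : ∀ {x} → x ∈ˢ p → 0 < ∣ p ∣
  x∈p⇒∣p∣>0 {x} x∈p = subst (_≤ ∣ p ∣) (∣⁅x⁆∣≡1 x) (p⊆q⇒∣p∣≤∣q∣ (x∈p⇒⁅x⁆⊆p x∈p))

  ∣p∣≡0⇒x∉p : ∀ {x} → ∣ p ∣ ≡ 0 → x ∉ˢ p
  ∣p∣≡0⇒x∉p ∣p∣≡0 x∈p = <-irrefl (sym ∣p∣≡0) (x∈p⇒∣p∣>0 x∈p)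

  ∣p∣≢0⇒nonempty : ∣ p ∣ ≢ 0 → Nonempty p
  ∣p∣≢0⇒nonempty ∣p∣≢0 with nonempty? p
  ... | yes ne = ne
  ... | no empty = contradiction (trans (cong ∣_∣ (Empty-unique empty)) (∣⊥∣≡0 n)) ∣p∣≢0

  ∣p∣≡1⇒x≡y : ∀ {x y} → ∣ p ∣ ≡ 1 → x ∈ˢ p → y ∈ˢ p → x ≡ y
  ∣p∣≡1⇒x≡y {x} {y} ∣p∣≡1 x∈p y∈p with x ≟ y
  ... | yes x≡y = x≡y
  ... | no x≢y = contradiction (p⊂q⇒∣p∣<∣q∣ ⁅x⁆⊂p) (<-irrefl (trans (∣⁅x⁆∣≡1 x) (sym ∣p∣≡1)))
    where
    ⁅x⁆⊂p : ⁅ x ⁆ ⊂ p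
    ⁅x⁆⊂p = x∈p⇒⁅x⁆⊆p x∈p , y , y∈p , x≢y⇒x∉⁅y⁆ (x≢y ∘ sym)

  ∣p∣≢1⇒other∈p : ∀ {x} → ∣ p ∣ ≢ 1 → x ∈ˢ p → ∃ λ y → y ∈ˢ p × y ≢ x
  ∣p∣≢1⇒other∈p {x} ∣p∣≢1 x∈p with any? (λ y → (y ∈ˢ? p) ×-dec ¬? (y ≟ x))
  ... | yes (y , y∈p , y≢x) = y , y∈p , y≢x
  ... | no none = contradiction (≤-antisym ∣p∣≤1 (x∈p⇒∣p∣>0 x∈p)) ∣p∣≢1
    where
    p⊆⁅x⁆ : p ⊆ ⁅ x ⁆
    p⊆⁅x⁆ {y} y∈p = subst (_∈ˢ ⁅ x ⁆)
      (sym (decidable-stable (y ≟ x) (λ y≢x → none (y , y∈p , y≢x)))) (x∈⁅x⁆ x)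
    ∣p∣≤1 : ∣ p ∣ ≤ 1
    ∣p∣≤1 = subst (∣ p ∣ ≤_) (∣⁅x⁆∣≡1 x) (p⊆q⇒∣p∣≤∣q∣ p⊆⁅x⁆)

module _ {a p} {A : Set a} {P : Pred A p} (P? : Decidable P) where

  find-accept : ∀ {x xs} → P x → find P? (x ∷ xs) ≡ just x
  find-accept {x} Px with P? x
  ... | yes _ = refl
  ... | no ¬Px = contradiction Px ¬Px

  find-Any : ∀ {xs} → Any P xs → ∃ λ y → find P? xs ≡ just y × P y
  find-Any {x ∷ xs} any with P? x
  ... | yes Px = x , refl , Px
  find-Any {x ∷ xs} (here Px)    | no ¬Px = contradiction Px ¬Px
  find-Any {x ∷ xs} (there anyP) | no _   = find-Any anyP

  find-++-All¬ : ∀ {xs ys} → All (¬_ ∘ P) xs → find P? (xs ++ ys) ≡ find P? ys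
  find-++-All¬ []                = refl
  find-++-All¬ {x ∷ _} (¬Px ∷ ¬Pxs) with P? x
  ... | yes Px = contradiction Px ¬Px
  ... | no _   = find-++-All¬ ¬Pxs

  find-swap : ∀ {x y zs} → ¬ (P x × P y) → find P? (x ∷ y ∷ zs) ≡ find P? (y ∷ x ∷ zs)
  find-swap {x} {y} ¬PxPy with P? x | P? y
  ... | yes Px | yes Py = contradiction (Px , Py) ¬PxPy
  ... | yes _  | no _   = refl
  ... | no _   | yes _  = refl
  ... | no _   | no _   = refl

  find-swap-after : ∀ ws {x y zs} → (P x → P y → Any P ws) →
                    find P? (ws ++ x ∷ y ∷ zs) ≡ find P? (ws ++ y ∷ x ∷ zs)
  find-swap-after [] {zs = zs} both⇒any = find-swap {zs = zs} λ (Px , Py) → ¬Any[] (both⇒any Px Py)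
  find-swap-after (w ∷ ws) both⇒any with P? w
  ... | yes _  = refl
  ... | no ¬Pw = find-swap-after ws λ Px Py → drop (both⇒any Px Py)
    where drop : Any P (w ∷ ws) → Any P ws
          drop (here Pw)    = contradiction Pw ¬Pw
          drop (there anyP) = anyP

find-mono : ∀ {a p q} {A : Set a} {P : Pred A p} {Q : Pred A q}
            (P? : Decidable P) (Q? : Decidable Q) → (∀ {z} → Q z → P z) →
            ∀ {xs y} → find P? xs ≡ just y → Q y → find Q? xs ≡ just y
find-mono P? Q? Q⇒P {x ∷ xs} eq Qy with P? x | Q? x
find-mono P? Q? Q⇒P {x ∷ xs} refl Qy | yes _ | yes _  = refl
find-mono P? Q? Q⇒P {x ∷ xs} refl Qy | yes _ | no ¬Qx = contradiction Qy ¬Qx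
... | no ¬Px | yes Qx = contradiction (Q⇒P Qx) ¬Px
... | no _   | no _   = find-mono P? Q? Q⇒P {xs} eq Qy

module _ {a} {A : Set a} where

  ∈-─⁺ : ∀ {x z} {ys : List A} (x∈ys : x ∈ ys) → z ∈ ys → z ≢ x → z ∈ ys ─ x∈ys
  ∈-─⁺ (here refl)  (here refl)  z≢x = contradiction refl z≢x
  ∈-─⁺ (here refl)  (there z∈ys) _   = z∈ys
  ∈-─⁺ (there _)    (here refl)  _   = here refl
  ∈-─⁺ (there x∈ys) (there z∈ys) z≢x = there (∈-─⁺ x∈ys z∈ys z≢x)

  Unique-⊆⇒length≤ : ∀ {xs ys : List A} → Unique xs → xs ⊆ˡ ys → length xs ≤ length ys
  Unique-⊆⇒length≤ {[]}     _              _     = z≤n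
  Unique-⊆⇒length≤ {x ∷ xs} {ys} (x∉xs ∷ uniq) xs⊆ys = subst (suc (length xs) ≤_)
    (sym (length-removeAt′ ys (index x∈ys)))
    (s≤s (Unique-⊆⇒length≤ uniq λ z∈xs →
      ∈-─⁺ x∈ys (xs⊆ys (there z∈xs)) (λ z≡x → All.lookup x∉xs z∈xs (sym z≡x))))
    where
    x∈ys : x ∈ ys
    x∈ys = xs⊆ys (here refl)

  length-filter+length-filter¬ : ∀ {p} {P : Pred A p} (P? : Decidable P) xs →
    length (filter P? xs) + length (filter (¬? ∘ P?) xs) ≡ length xs
  length-filter+length-filter¬ P? []       = refl
  length-filter+length-filter¬ P? (x ∷ xs) with P? x
  ... | yes _ = cong suc (length-filter+length-filter¬ P? xs)
  ... | no _  = trans (+-suc _ _) (cong suc (length-filter+length-filter¬ P? xs))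

  Unique-sublist-of-length : ∀ {q} {Q : Pred A q} {xs} r → Unique xs → All Q xs → r ≤ length xs →
    ∃ λ ys → Unique ys × All Q ys × length ys ≡ r
  Unique-sublist-of-length {xs = xs} r uniq all r≤ =
    take r xs , Unique.take⁺ r uniq , Allₚ.take⁺ r all , trans (length-take r xs) (m≤n⇒m⊓n≡m r≤)

  Card-complement : ∀ {q p d} {Q : Pred A q} {P : Pred A p} {D : Pred A d} {N c} →
    Card Q N → Card (λ z → Q z × P z) c → Decidable D → (∀ {z} → Q z → D z → P z) →
    ∃ λ xs → Unique xs × All (λ z → Q z × ¬ D z) xs × N ∸ c ≤ length xs
  Card-complement {Q = Q} {D = D} (all , uniq , ∈all⇔Q , refl) (withP , _ , ∈withP⇔QP , refl) D? QD⇒P =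
    filter (¬? ∘ D?) all , Unique.filter⁺ (¬? ∘ D?) uniq , All.tabulate outside-D , N∸c≤
    where
    open ≤-Reasoning
    in-all : ∀ {z} → z ∈ all → Q z
    in-all = Equivalence.to (∈all⇔Q _)
    outside-D : ∀ {z} → z ∈ filter (¬? ∘ D?) all → Q z × ¬ D z
    outside-D z∈ with z∈all , ¬Dz ← ∈-filter⁻ (¬? ∘ D?) z∈ = in-all z∈all , ¬Dz
    inside-D⊆withP : filter D? all ⊆ˡ withP
    inside-D⊆withP z∈ with z∈all , Dz ← ∈-filter⁻ D? z∈ =
      Equivalence.from (∈withP⇔QP _) (in-all z∈all , QD⇒P (in-all z∈all) Dz)
    N∸c≤ : length all ∸ length withP ≤ length (filter (¬? ∘ D?) all)
    N∸c≤ = begin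
      length all ∸ length withP                 ≤⟨ ∸-monoʳ-≤ (length all)
                                                     (Unique-⊆⇒length≤ (Unique.filter⁺ D? uniq) inside-D⊆withP) ⟩
      length all ∸ length (filter D? all)       ≡⟨ cong (_∸ length (filter D? all))
                                                     (sym (length-filter+length-filter¬ D? all)) ⟩
      length (filter D? all) + length (filter (¬? ∘ D?) all) ∸ length (filter D? all)
                                                ≡⟨ m+n∸m≡n (length (filter D? all)) _ ⟩
      length (filter (¬? ∘ D?) all)             ∎

module _ {n : ℕ} (G : Digraph n) where

  ∈inNbrs⇒Edge : ∀ {u v} → u ∈ˢ inNbrs G v → Edge G u v
  ∈inNbrs⇒Edge {u} {v} u∈ = lookup⇒[]= v (G u)
    (trans (sym (lookup∘tabulate (λ w → lookup (G w) v) u)) ([]=⇒lookup u∈))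

  Edge⇒∈inNbrs : ∀ {u v} → Edge G u v → u ∈ˢ inNbrs G v
  Edge⇒∈inNbrs {u} {v} e = lookup⇒[]= u (inNbrs G v)
    (trans (lookup∘tabulate (λ w → lookup (G w) v) u) ([]=⇒lookup e))

  Source⇒¬Edge : ∀ {u v} → IsSource G v → ¬ Edge G u v
  Source⇒¬Edge source e = ∣p∣≡0⇒x∉p source (Edge⇒∈inNbrs e)

  ¬Source⇒Edge : ∀ {v} → ¬ IsSource G v → ∃ λ u → Edge G u v
  ¬Source⇒Edge ¬source with u , u∈ ← ∣p∣≢0⇒nonempty ¬source = u , ∈inNbrs⇒Edge u∈

  Sink⇒¬Edge : ∀ {u v} → IsSink G u → ¬ Edge G u v
  Sink⇒¬Edge = ∣p∣≡0⇒x∉p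

  ¬Sink⇒Edge : ∀ {u} → ¬ IsSink G u → ∃ λ v → Edge G u v
  ¬Sink⇒Edge = ∣p∣≢0⇒nonempty

  isSource? : ∀ v → Dec (IsSource G v)
  isSource? v = ∣ inNbrs G v ∣ ℕ.≟ 0

  isSink? : ∀ v → Dec (IsSink G v)
  isSink? v = ∣ G v ∣ ℕ.≟ 0

module _ {n : ℕ} {G : Digraph n} where

  infixr 5 _++ʷ_
  _++ʷ_ : ∀ {u v w} → Walk G u v → Walk G v w → Walk G u w
  here       ++ʷ W′ = W′
  step e W   ++ʷ W′ = step e (W ++ʷ W′)

  infixl 5 _▻_
  _▻_ : ∀ {u v w} → Walk G u v → Edge G v w → Walk G u w
  W ▻ e = W ++ʷ step e here

  vertices : ∀ {u v} → Walk G u v → List (Fin n)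
  vertices {u} here       = u ∷ []
  vertices {u} (step e W) = u ∷ vertices W

  length-vertices-▻ : ∀ {u v w} (W : Walk G u v) (e : Edge G v w) →
                      length (vertices (W ▻ e)) ≡ suc (length (vertices W))
  length-vertices-▻ here       e = refl
  length-vertices-▻ (step _ W) e = cong suc (length-vertices-▻ W e)

  ∈vertices⇒Walk : ∀ {u v x} (W : Walk G u v) → x ∈ vertices W → Walk G u x
  ∈vertices⇒Walk here       (here refl) = here
  ∈vertices⇒Walk (step e W) (here refl) = here
  ∈vertices⇒Walk (step e W) (there x∈)  = step e (∈vertices⇒Walk W x∈)

  Walk-to-Source : ∀ {u v} → IsSource G v → Walk G u v → u ≡ v
  Walk-to-Source source here       = refl
  Walk-to-Source source (step e W) with refl ← Walk-to-Source source W =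
    contradiction e (Source⇒¬Edge G source)

  last-edge : ∀ {u v} → Walk G u v → u ≢ v → ∃ λ w → Walk G u w × Edge G w v
  last-edge here                u≢v = contradiction refl u≢v
  last-edge {u} {v} (step {w = w} e W) u≢v with w ≟ v
  ... | yes refl = u , here , e
  ... | no w≢v with z , W′ , e′ ← last-edge W w≢v = z , step e W′ , e′

  crossing : ∀ {q} {Q : Pred (Fin n) q} → Decidable Q → ∀ {u t} → Walk G u t → ¬ Q u → Q t →
             ∃ λ w → ∃ λ x → Walk G u w × Edge G w x × ¬ Q w × Q x
  crossing Q? here ¬Qu Qt = contradiction Qt ¬Qu
  crossing Q? {u} (step {w = w} e W) ¬Qu Qt with Q? w
  ... | yes Qw = u , w , here , e , ¬Qu , Qw
  ... | no ¬Qw with w′ , x , W′ , e′ , ¬Qw′ , Qx ← crossing Q? W ¬Qw Qt =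
    w′ , x , step e W′ , e′ , ¬Qw′ , Qx

record BracketsDifferingAt {n : ℕ} (G : Digraph n) (x a b : Fin n) : Set where
  field
    B₁ B₂           : Bracket G
    B₁-isBracket    : IsBracket G B₁
    B₂-isBracket    : IsBracket G B₂
    B₁[x]≡a         : lookup B₁ x ≡ a
    B₂[x]≡b         : lookup B₂ x ≡ b
    agree-elsewhere : ∀ y → y ≢ x → lookup B₁ y ≡ lookup B₂ y

module SingleElimination {n : ℕ} {G : Digraph n} (T : IsSingleElimination G) where
  open IsSingleElimination T
  open DecMembership (_≟_ {n}) using (_∈?_)

  Edge-functional : ∀ {u w w′} → Edge G u w → Edge G u w′ → w ≡ w′
  Edge-functional {u} e e′ = ∣p∣≡1⇒x≡y (outDegOne u (λ u-sink → Sink⇒¬Edge G u-sink e)) e e′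

  Walk-comparable : ∀ {a u v} → Walk G a u → Walk G a v → Walk G u v ⊎ Walk G v u
  Walk-comparable here       W′          = inj₁ W′
  Walk-comparable (step e W) here        = inj₂ (step e W)
  Walk-comparable (step e W) (step e′ W′) with refl ← Edge-functional e e′ = Walk-comparable W W′

  vertices-Unique : ∀ {u v} (W : Walk G u v) → Unique (vertices W)
  vertices-Unique here       = [] ∷ []
  vertices-Unique (step e W) =
    All.tabulate (λ { u∈W refl → acyclic _ _ e (∈vertices⇒Walk W u∈W) }) ∷ vertices-Unique W

  length-vertices≤n : ∀ {u v} (W : Walk G u v) → length (vertices W) ≤ n
  length-vertices≤n W = subst (length (vertices W) ≤_) (length-tabulate id)
    (Unique-⊆⇒length≤ (vertices-Unique W) (λ {x} _ → ∈-allFin x))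

  private
    toward-sink : ∀ k u → (∃ λ s → IsSink G s × Walk G u s) ⊎
                          (∃ λ w → Σ (Walk G u w) λ W → k ≤ length (vertices W))
    toward-sink zero    u = inj₂ (u , here , z≤n)
    toward-sink (suc k) u with isSink? G u
    ... | yes u-sink = inj₁ (u , u-sink , here)
    ... | no ¬u-sink with w , e ← ¬Sink⇒Edge G ¬u-sink =
      Sum.map (λ (s , s-sink , W) → s , s-sink , step e W) (λ (w′ , W , k≤) → w′ , step e W , s≤s k≤)
              (toward-sink k w)

    toward-player : ∀ k v → (∃ λ a → InPlayerSet G a v) ⊎
                            (∃ λ w → Σ (Walk G w v) λ W → k ≤ length (vertices W))
    toward-player zero    v = inj₂ (v , here , z≤n)
    toward-player (suc k) v with isSource? G v
    ... | yes source = inj₁ (v , source , here)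
    ... | no ¬source with u , e ← ¬Source⇒Edge G ¬source =
      Sum.map (λ (a , player , W) → a , player , W ▻ e)
              (λ (w , W , k≤) → w , W ▻ e , subst (suc k ≤_) (sym (length-vertices-▻ W e)) (s≤s k≤))
              (toward-player k u)

  sink : Fin n
  sink = proj₁ uniqueSink

  reaches-sink : ∀ u → Walk G u sink
  reaches-sink u with toward-sink (suc n) u
  ... | inj₁ (s , s-sink , W) = subst (Walk G u) (proj₂ (proj₂ uniqueSink) s s-sink) W
  ... | inj₂ (_ , W , n<len) = contradiction n<len (≤⇒≯ (length-vertices≤n W))

  reached-by-player : ∀ v → ∃ λ a → InPlayerSet G a v
  reached-by-player v with toward-player (suc n) v
  ... | inj₁ a∈P[v]          = a∈P[v]
  ... | inj₂ (_ , W , n<len) = contradiction n<len (≤⇒≯ (length-vertices≤n W))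

  Walk⇒∈vertices : ∀ {u v s} (P : Walk G u s) → IsSink G s → Walk G u v → v ∈ vertices P
  Walk⇒∈vertices here        _      here       = here refl
  Walk⇒∈vertices (step _ _)  _      here       = here refl
  Walk⇒∈vertices here        s-sink (step e _) = contradiction e (Sink⇒¬Edge G s-sink)
  Walk⇒∈vertices (step e′ P) s-sink (step e W) with refl ← Edge-functional e e′ =
    there (Walk⇒∈vertices P s-sink W)

  walk? : ∀ u v → Dec (Walk G u v)
  walk? u v = Dec.map′ (∈vertices⇒Walk P) (Walk⇒∈vertices P (proj₁ (proj₂ uniqueSink))) (v ∈? vertices P)
    where
    P : Walk G u sink
    P = reaches-sink u

  inPlayerSet? : ∀ a v → Dec (InPlayerSet G a v)
  inPlayerSet? a v = isSource? G a ×-dec walk? a v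

  -- The fallback v of fromMaybe is never used when ps lists every player.
  priorityBracket : List (Fin n) → Bracket G
  priorityBracket ps = tabulate λ v → fromMaybe v (find (λ a → inPlayerSet? a v) ps)

  lookup-priorityBracket : ∀ ps v →
    lookup (priorityBracket ps) v ≡ fromMaybe v (find (λ a → inPlayerSet? a v) ps)
  lookup-priorityBracket ps v = lookup∘tabulate _ v

  lookup-priorityBracket-just : ∀ ps {v a} → find (λ c → inPlayerSet? c v) ps ≡ just a →
                                lookup (priorityBracket ps) v ≡ a
  lookup-priorityBracket-just ps {v} found =
    trans (lookup-priorityBracket ps v) (cong (fromMaybe v) found)

  priorityBracket-first : ∀ cs {a v} rest → All (λ c → ¬ InPlayerSet G c v) cs → InPlayerSet G a v →
                          lookup (priorityBracket (cs ++ a ∷ rest)) v ≡ a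
  priorityBracket-first cs {v = v} rest cs∉P[v] a∈P[v] = lookup-priorityBracket-just (cs ++ _ ∷ rest)
    (trans (find-++-All¬ (λ c → inPlayerSet? c v) {ys = _ ∷ rest} cs∉P[v])
           (find-accept (λ c → inPlayerSet? c v) {xs = rest} a∈P[v]))

  priorityBracket-swap : ∀ cs {a b} rest v →
    (InPlayerSet G a v → InPlayerSet G b v → Any (λ c → InPlayerSet G c v) cs) →
    lookup (priorityBracket (cs ++ a ∷ b ∷ rest)) v ≡ lookup (priorityBracket (cs ++ b ∷ a ∷ rest)) v
  priorityBracket-swap cs rest v both⇒cs = trans (lookup-priorityBracket (cs ++ _ ∷ _ ∷ rest) v)
    (trans (cong (fromMaybe v) (find-swap-after (λ c → inPlayerSet? c v) cs both⇒cs))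
           (sym (lookup-priorityBracket (cs ++ _ ∷ _ ∷ rest) v)))

  module _ (ps : List (Fin n)) (lists-players : ∀ a → IsPlayer G a → a ∈ ps) where

    first-entrant : ∀ v → ∃ λ a → find (λ c → inPlayerSet? c v) ps ≡ just a × InPlayerSet G a v
    first-entrant v with a , a∈P[v] ← reached-by-player v =
      find-Any (λ c → inPlayerSet? c v) (lose (lists-players a (proj₁ a∈P[v])) a∈P[v])

    priorityBracket-isBracket : IsBracket G (priorityBracket ps)
    priorityBracket-isBracket = record
      { intoPlayers = λ v → let a , found , player , _ = first-entrant v in
          subst (IsPlayer G) (sym (lookup-priorityBracket-just ps found)) player
      ; onPlayers = λ a player → let c , found , _ , c⇝a = first-entrant a in
          trans (lookup-priorityBracket-just ps found) (Walk-to-Source player c⇝a)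
      ; onMatches = onMatches
      }
      where
      onMatches : ∀ x → IsMatch G x → ∃ λ u → u ∈ˢ inNbrs G x ×
                  lookup (priorityBracket ps) x ≡ lookup (priorityBracket ps) u
      onMatches x match
        with a , found , player , a⇝x ← first-entrant x
        with u , a⇝u , u→x ← last-edge a⇝x (λ a≡x → match (subst (IsSource G) a≡x player)) =
        u , Edge⇒∈inNbrs G u→x ,
        trans (lookup-priorityBracket-just ps found)
              (sym (lookup-priorityBracket-just ps
                (find-mono (λ c → inPlayerSet? c x) (λ c → inPlayerSet? c u)
                  (λ (player , W) → player , W ▻ u→x) {ps} found (player , a⇝u))))

  beyond-edge : ∀ {u x v} → Edge G u x → Walk G u v → u ≡ v ⊎ Walk G x v
  beyond-edge u→x here        = inj₁ refl
  beyond-edge u→x (step e W) with refl ← Edge-functional u→x e = inj₂ W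

  sibling-unreachable : ∀ {u w p} → Edge G u p → Edge G w p → u ≢ w → ¬ Walk G u w
  sibling-unreachable u→p w→p u≢w u⇝w with beyond-edge u→p u⇝w
  ... | inj₁ u≡w = u≢w u≡w
  ... | inj₂ p⇝w = acyclic _ _ w→p p⇝w

  no-walks-to-both-siblings : ∀ {u w p c} → Edge G u p → Edge G w p → u ≢ w →
                              Walk G c u → Walk G c w → ⊥
  no-walks-to-both-siblings u→p w→p u≢w c⇝u c⇝w with Walk-comparable c⇝u c⇝w
  ... | inj₁ u⇝w = sibling-unreachable u→p w→p u≢w u⇝w
  ... | inj₂ w⇝u = sibling-unreachable w→p u→p (u≢w ∘ sym) w⇝u

  record Meeting (a b : Fin n) : Set where
    field
      x uᵃ uᵇ : Fin n
      uᵃ→x  : Edge G uᵃ x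
      uᵇ→x  : Edge G uᵇ x
      a⇝uᵃ  : Walk G a uᵃ
      b⇝uᵇ  : Walk G b uᵇ
      ¬b⇝uᵃ : ¬ Walk G b uᵃ
      ¬a⇝uᵇ : ¬ Walk G a uᵇ

    common-reach : ∀ {v} → Walk G a v → Walk G b v → Walk G x v
    common-reach a⇝v b⇝v with Walk-comparable a⇝uᵃ a⇝v
    ... | inj₂ v⇝uᵃ = contradiction (b⇝v ++ʷ v⇝uᵃ) ¬b⇝uᵃ
    ... | inj₁ uᵃ⇝v with beyond-edge uᵃ→x uᵃ⇝v
    ...   | inj₁ refl = contradiction b⇝v ¬b⇝uᵃ
    ...   | inj₂ x⇝v  = x⇝v

  -- x is the first vertex on a's path to the sink that b reaches as well.
  meeting : ∀ {a b} → IsPlayer G a → IsPlayer G b → a ≢ b → Meeting a b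
  meeting {a} {b} a-player b-player a≢b
    with uᵃ , x , a⇝uᵃ , uᵃ→x , ¬b⇝uᵃ , b⇝x
           ← crossing (walk? b) (reaches-sink a) (λ b⇝a → a≢b (sym (Walk-to-Source a-player b⇝a)))
                      (reaches-sink b)
    with uᵇ , b⇝uᵇ , uᵇ→x
           ← last-edge b⇝x (λ b≡x → Source⇒¬Edge G (subst (IsSource G) b≡x b-player) uᵃ→x) =
    record
      { x = x ; uᵃ = uᵃ ; uᵇ = uᵇ ; uᵃ→x = uᵃ→x ; uᵇ→x = uᵇ→x ; a⇝uᵃ = a⇝uᵃ ; b⇝uᵇ = b⇝uᵇ
      ; ¬b⇝uᵃ = ¬b⇝uᵃ
      ; ¬a⇝uᵇ = no-walks-to-both-siblings uᵃ→x uᵇ→x (λ { refl → ¬b⇝uᵃ b⇝uᵇ }) a⇝uᵃ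
      }

  meeting-isXab : ∀ {a b} (a-player : IsPlayer G a) (b-player : IsPlayer G b) (a≢b : a ≢ b) →
                  IsXab G a b (Meeting.x (meeting a-player b-player a≢b))
  meeting-isXab a-player b-player a≢b =
    (λ source → Source⇒¬Edge G source uᵃ→x) , uᵃ , uᵇ ,
    Edge⇒∈inNbrs G uᵃ→x , Edge⇒∈inNbrs G uᵇ→x ,
    ((a-player , a⇝uᵃ) , ¬b⇝uᵃ ∘ proj₂) , ((b-player , b⇝uᵇ) , ¬a⇝uᵇ ∘ proj₂)
    where open Meeting (meeting a-player b-player a≢b)

  -- A player reaching the other in-neighbour of x's successor reaches every vertex after x, but not x.
  beyond-cover : ∀ x → ∃ λ cs → All (λ c → ¬ InPlayerSet G c x) cs ×
                 (∀ {v} → Walk G x v → v ≢ x → Any (λ c → InPlayerSet G c v) cs)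
  beyond-cover x with isSink? G x
  ... | yes x-sink = [] , [] , λ where
    here       x≢x → contradiction refl x≢x
    (step e _) _   → contradiction e (Sink⇒¬Edge G x-sink)
  ... | no ¬x-sink
    with p , x→p ← ¬Sink⇒Edge G ¬x-sink
    with w , w∈ , w≢x ← ∣p∣≢1⇒other∈p (inDegNotOne p) (Edge⇒∈inNbrs G x→p)
    with c , c-player , c⇝w ← reached-by-player w =
      c ∷ [] ,
      (λ (_ , c⇝x) → no-walks-to-both-siblings w→p x→p w≢x c⇝w c⇝x) ∷ [] ,
      λ x⇝v v≢x → here (c-player , c⇝ x⇝v v≢x)
    where
    w→p : Edge G w p
    w→p = ∈inNbrs⇒Edge G w∈
    c⇝ : ∀ {v} → Walk G x v → v ≢ x → Walk G c v
    c⇝ x⇝v v≢x with beyond-edge x→p x⇝v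
    ... | inj₁ x≡v = contradiction (sym x≡v) v≢x
    ... | inj₂ p⇝v = (c⇝w ▻ w→p) ++ʷ p⇝v

  bracketsDifferingAt : ∀ {x a b} cs → All (λ c → ¬ InPlayerSet G c x) cs →
    InPlayerSet G a x → InPlayerSet G b x →
    (∀ {v} → InPlayerSet G a v → InPlayerSet G b v → v ≢ x → Any (λ c → InPlayerSet G c v) cs) →
    BracketsDifferingAt G x a b
  bracketsDifferingAt {a = a} {b} cs cs∉P[x] a∈P[x] b∈P[x] both⇒cs = record
    { B₁ = priorityBracket (cs ++ a ∷ b ∷ allFin n)
    ; B₂ = priorityBracket (cs ++ b ∷ a ∷ allFin n)
    ; B₁-isBracket = priorityBracket-isBracket _ (lists-players a b)
    ; B₂-isBracket = priorityBracket-isBracket _ (lists-players b a)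
    ; B₁[x]≡a = priorityBracket-first cs (b ∷ allFin n) cs∉P[x] a∈P[x]
    ; B₂[x]≡b = priorityBracket-first cs (a ∷ allFin n) cs∉P[x] b∈P[x]
    ; agree-elsewhere = λ y y≢x →
        priorityBracket-swap cs (allFin n) y λ a∈P[y] b∈P[y] → both⇒cs a∈P[y] b∈P[y] y≢x
    }
    where
    lists-players : ∀ a b c → IsPlayer G c → c ∈ cs ++ a ∷ b ∷ allFin n
    lists-players _ _ c _ = ∈-++⁺ʳ cs (there (there (∈-allFin c)))

  bracketsDifferingAt-xab : ∀ {a b} (a-player : IsPlayer G a) (b-player : IsPlayer G b) (a≢b : a ≢ b) →
    BracketsDifferingAt G (Meeting.x (meeting a-player b-player a≢b)) a b
  bracketsDifferingAt-xab a-player b-player a≢b =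
    let cs , cs∉P[x] , cs-beyond-x = beyond-cover x in
    bracketsDifferingAt cs cs∉P[x] (a-player , a⇝uᵃ ▻ uᵃ→x) (b-player , b⇝uᵇ ▻ uᵇ→x)
      λ (_ , a⇝v) (_ , b⇝v) v≢x → cs-beyond-x (common-reach a⇝v b⇝v) v≢x
    where open Meeting (meeting a-player b-player a≢b)

module _ {c ℓ : Level} (R : CommutativeMonoid c ℓ) {n : ℕ} {G : Digraph n} where
  open Scoring R G
  open CommutativeMonoid R using (_∙_; ε; reflexive)

  score-agree-off : ∀ σ {B B₁ B₂ : Bracket G} x → (∀ y → y ≢ x → lookup B₁ y ≡ lookup B₂ y) →
                    lookup B x ≢ lookup B₁ x → lookup B x ≢ lookup B₂ x → score σ B B₁ ≡ score σ B B₂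
  score-agree-off σ {B} {B₁} {B₂} x agree B[x]≢B₁[x] B[x]≢B₂[x] =
    cong (foldr (λ y acc → σ y ∙ acc) ε)
      (filter-≐ (λ y → lookup B y ≟ lookup B₁ y) (λ y → lookup B y ≟ lookup B₂ y)
        (transfer B₁ B₂ agree B[x]≢B₁[x] , transfer B₂ B₁ (λ y y≢x → sym (agree y y≢x)) B[x]≢B₂[x])
        (filter (isMatch? G) (allFin n)))
    where
    transfer : ∀ (B′ B″ : Bracket G) → (∀ y → y ≢ x → lookup B′ y ≡ lookup B″ y) →
               lookup B x ≢ lookup B′ x → ∀ {y} → lookup B y ≡ lookup B′ y → lookup B y ≡ lookup B″ y
    transfer B′ B″ agree′ B[x]≢B′[x] {y} B[y]≡B′[y] with y ≟ x
    ... | yes refl = contradiction B[y]≡B′[y] B[x]≢B′[x]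
    ... | no y≢x   = trans B[y]≡B′[y] (agree′ y y≢x)

  avoiding-not-resolving : ∀ σ {x a b} → BracketsDifferingAt G x a b → a ≢ b →
                           ∀ {L} → All (λ B → ¬ (lookup B x ≡ a ⊎ lookup B x ≡ b)) L → ¬ IsResolving σ L
  avoiding-not-resolving σ {x} differing a≢b avoid resolving =
    let Bᵢ , Bᵢ∈L , scores≉ = resolving B₁ B₂ B₁-isBracket B₂-isBracket B₁≢B₂ in
    scores≉ (reflexive (score-agree-off σ {Bᵢ} {B₁} {B₂} x agree-elsewhere
      (λ eq → All.lookup avoid Bᵢ∈L (inj₁ (trans eq B₁[x]≡a)))
      (λ eq → All.lookup avoid Bᵢ∈L (inj₂ (trans eq B₂[x]≡b)))))
    where
    open BracketsDifferingAt differing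
    B₁≢B₂ : B₁ ≢ B₂
    B₁≢B₂ B₁≡B₂ = a≢b (trans (sym B₁[x]≡a) (trans (cong (λ B → lookup B x) B₁≡B₂) B₂[x]≡b))

proposition4p4 : ∀ {c ℓ p : Level} (R : CommutativeMonoid c ℓ)
    (Pos : CommutativeMonoid.Carrier R → Set p)
    (n : ℕ) (G : Digraph n) → IsSingleElimination G →
    (Σ (Fin n) λ a → Σ (Fin n) λ b → IsPlayer G a × IsPlayer G b × a ≢ b) →
    (N : ℕ) → Card (IsBracket G) N →
    (cmin : ℕ) → IsMinPairCount G cmin →
    (σ : Fin n → CommutativeMonoid.Carrier R) →
    (∀ x → IsMatch G x → Pos (σ x)) →
    (r : ℕ) → Scoring.IsRes R G σ r →
    N ∸ cmin < r
proposition4p4 R _ n G T _ N brackets cmin ((a , b , a-player , b-player , a≢b , pair-brackets) , _)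
               σ _ r (resolving , _) =
  ≰⇒> λ r≤N∸cmin →
    let _ , unique , avoid , N∸cmin≤ = Card-complement brackets pair-brackets picks? picks⇒event
        L , uniqueL , avoidL , |L|≡r =
          Unique-sublist-of-length r unique avoid (≤-trans r≤N∸cmin N∸cmin≤)
    in avoiding-not-resolving R σ (bracketsDifferingAt-xab a-player b-player a≢b) a≢b
         (All.map proj₂ avoidL) (resolving L uniqueL (λ _ B∈L → proj₁ (All.lookup avoidL B∈L)) |L|≡r)
  where
  open SingleElimination T
  x : Fin n
  x = Meeting.x (meeting a-player b-player a≢b)
  picks? : ∀ (B : Bracket G) → Dec (lookup B x ≡ a ⊎ lookup B x ≡ b)
  picks? B = (lookup B x ≟ a) ⊎-dec (lookup B x ≟ b)
  picks⇒event : ∀ {B} → IsBracket G B → lookup B x ≡ a ⊎ lookup B x ≡ b → PairEvent G a b B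
  picks⇒event _ picks = x , meeting-isXab a-player b-player a≢b , picks
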